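{- Let $G$ be a spanning subgraph of $K_{n,n,n}$. Let $W$ be the inclusion matrix of $E(K_{n,n,n})$ versus the set of triangles of $K_{n,n,n}$, $M = WW^\top$, and $K$ the matrix of orthogonal projection of $\mathbb{R}^{E(K_{n,n,n})}$ onto $\ker(M)$. Let $W_G$ be the inclusion matrix of $E(G)$ versus the set $T(G)$ of triangles of $G$, and $M_G = W_G W_G^\top$. Then $K[G]\, M_G = O$.
   Context: $K_{n,n,n}$ is the complete $3$-partite graph with three parts of size $n$. The inclusion matrix of edges versus triangles has $(e,t)$-entry $1$ if $e\subseteq t$ and $0$ otherwise. For a square matrix $A$ indexed by $E(K_{n,n,n})$, $A[G]$ denotes its principal submatrix with rows and columns indexed by $E(G)$.
   Formalization: The coefficient field is ℚ rather than ℝ, so the projection K onto ker(M) has rational entries and acts on rational vectors indexed by $E(K_{n,n,n})$. -}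

module Defs where

open import Data.Bool using (Bool; true; false; _∧_; if_then_else_)
open import Data.Nat using (ℕ)
open import Data.Fin using (Fin)
open import Data.Fin.Properties using () renaming (_≟_ to _≟ᶠ_)
open import Data.List using (List; []; _∷_; foldr; map; concatMap; filter)
open import Data.List.Base using (allFin)
open import Data.Product using (_×_; _,_)
open import Data.Rational using (ℚ; 0ℚ; 1ℚ; _+_; _*_; _-_)
open import Relation.Nullary.Decidable using (⌊_⌋)
open import Relation.Binary.PropositionalEquality using (_≡_)

-- Vertices of K_{n,n,n}: (part, index) with parts 0,1,2 and index in Fin n.
-- An edge joins two different parts; we name the unordered pair of parts.
data PartPair : Set where
  p01 p02 p12 : PartPair

-- Edge (p01 , a , b) = {(0,a),(1,b)};  (p02 , a , c) = {(0,a),(2,c)};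
-- (p12 , b , c) = {(1,b),(2,c)}.  This enumerates E(K_{n,n,n}) bijectively.
Edge : ℕ → Set
Edge n = PartPair × Fin n × Fin n

-- Triangle (a , b , c) = {(0,a),(1,b),(2,c)}; these are all triangles of K_{n,n,n}.
Triangle : ℕ → Set
Triangle n = Fin n × Fin n × Fin n

allPairs : List PartPair
allPairs = p01 ∷ p02 ∷ p12 ∷ []

allEdges : (n : ℕ) → List (Edge n)
allEdges n = concatMap (λ p → concatMap (λ a → map (λ b → p , a , b) (allFin n)) (allFin n)) allPairs

allTriangles : (n : ℕ) → List (Triangle n)
allTriangles n = concatMap (λ a → concatMap (λ b → map (λ c → a , b , c) (allFin n)) (allFin n)) (allFin n)

_⊆ᵗ_ : {n : ℕ} → Edge n → Triangle n → Bool
(p01 , x , y) ⊆ᵗ (a , b , c) = ⌊ x ≟ᶠ a ⌋ ∧ ⌊ y ≟ᶠ b ⌋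
(p02 , x , y) ⊆ᵗ (a , b , c) = ⌊ x ≟ᶠ a ⌋ ∧ ⌊ y ≟ᶠ c ⌋
(p12 , x , y) ⊆ᵗ (a , b , c) = ⌊ x ≟ᶠ b ⌋ ∧ ⌊ y ≟ᶠ c ⌋

Σ[_]_ : {A : Set} → List A → (A → ℚ) → ℚ
Σ[ xs ] f = foldr (λ x acc → f x + acc) 0ℚ xs

W : (n : ℕ) → Edge n → Triangle n → ℚ
W n e t = if e ⊆ᵗ t then 1ℚ else 0ℚ

M : (n : ℕ) → Edge n → Edge n → ℚ
M n e f = Σ[ allTriangles n ] (λ t → W n e t * W n f t)

Vect : ℕ → Set
Vect n = Edge n → ℚ

_·ᵥ_ : {n : ℕ} → (Edge n → Edge n → ℚ) → Vect n → Vect n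
_·ᵥ_ {n} A x e = Σ[ allEdges n ] (λ f → A e f * x f)

inner : {n : ℕ} → Vect n → Vect n → ℚ
inner {n} x y = Σ[ allEdges n ] (λ e → x e * y e)

InKerM : (n : ℕ) → Vect n → Set
InKerM n x = ∀ e → (M n ·ᵥ x) e ≡ 0ℚ

IsOrthProjKerM : (n : ℕ) → (Edge n → Edge n → ℚ) → Set
IsOrthProjKerM n K =
  ∀ (x : Vect n) → InKerM n (K ·ᵥ x) ×
    (∀ (y : Vect n) → InKerM n y → inner (λ e → x e - (K ·ᵥ x) e) y ≡ 0ℚ)

-- A spanning subgraph G of K_{n,n,n} is given by its edge set (all vertices kept).
Subgraph : ℕ → Set
Subgraph n = Edge n → Bool

edgesOf : {n : ℕ} → Subgraph n → List (Edge n)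
edgesOf {n} G = filter (λ e → G e Data.Bool.≟ true) (allEdges n)
  where import Data.Bool

triangleIn : {n : ℕ} → Subgraph n → Triangle n → Bool
triangleIn G (a , b , c) = G (p01 , a , b) ∧ G (p02 , a , c) ∧ G (p12 , b , c)

trianglesOf : {n : ℕ} → Subgraph n → List (Triangle n)
trianglesOf {n} G = filter (λ t → triangleIn G t Data.Bool.≟ true) (allTriangles n)
  where import Data.Bool

-- W_G : inclusion matrix E(G) × T(G) (entries for e ∈ E(G), t ∈ T(G))
WG : {n : ℕ} → Subgraph n → Edge n → Triangle n → ℚ
WG G e t = if e ⊆ᵗ t then 1ℚ else 0ℚ

MG : {n : ℕ} → Subgraph n → Edge n → Edge n → ℚ
MG G e f = Σ[ trianglesOf G ] (λ t → WG G e t * WG G f t)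

KG-MG : {n : ℕ} → (Edge n → Edge n → ℚ) → Subgraph n → Edge n → Edge n → ℚ
KG-MG K G e f = Σ[ edgesOf G ] (λ g → K e g * MG G g f)

module Submission where

-- Writing w_t for the column of W indexed by the triangle t, the (e,f) entry of K[G] M_G is
-- the sum over t ∈ T(G) of (K w_t)_e (w_t)_f, because an edge outside G lies in no triangle
-- of G.  Now xᵀ M x = |Wᵀ x|², so ker M = ker Wᵀ and every column w_t is orthogonal to
-- ker M; the orthogonal projection onto ker M therefore kills it, and K w_t = 0.

open import Defs
open import Data.Bool using (true; false; _∧_) renaming (_≟_ to _≟ᵇ_)
open import Data.Bool.Properties using (T-≡)
open import Data.Empty using (⊥-elim)
open import Data.Fin using (Fin)
open import Data.Fin.Properties using () renaming (_≟_ to _≟ᶠ_)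
open import Data.List using (List; []; _∷_; filter; concatMap; map; allFin)
open import Data.List.Membership.Propositional using (_∈_; lose)
open import Data.List.Membership.Propositional.Properties
  using (∈-allFin; ∈-map⁺; ∈-concatMap⁺; ∈-filter⁻)
open import Data.List.Relation.Unary.Any using (here; there)
open import Data.Nat using (ℕ)
open import Data.Product using (_×_; _,_; proj₁; proj₂)
open import Data.Rational
  using (ℚ; 0ℚ; 1ℚ; _+_; _*_; _-_; _≤_; 1/_; ≢-nonZero; nonNegative; nonPositive)
open import Data.Rational.Properties
open import Data.Sum using (inj₁; inj₂)
open import Function using (Equivalence)
open import Relation.Binary.PropositionalEquality
open import Relation.Nullary using (¬_; yes; no)
open import Relation.Nullary.Decidable using (⌊_⌋; toWitness; dec⇒maybe)
open import Relation.Unary using (Decidable)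
open import Tactic.RingSolver using (solve-∀)
open import Tactic.RingSolver.Core.AlmostCommutativeRing
  using (AlmostCommutativeRing; fromCommutativeRing)

ℚ-ring : AlmostCommutativeRing _ _
ℚ-ring = fromCommutativeRing +-*-commutativeRing (λ x → dec⇒maybe (0ℚ ≟ x))

module _ {A : Set} where

  Σ-cong : (xs : List A) {f g : A → ℚ} → (∀ x → f x ≡ g x) → Σ[ xs ] f ≡ Σ[ xs ] g
  Σ-cong []       f≡g = refl
  Σ-cong (x ∷ xs) f≡g = cong₂ _+_ (f≡g x) (Σ-cong xs f≡g)

  Σ-zero : (xs : List A) (f : A → ℚ) → (∀ x → x ∈ xs → f x ≡ 0ℚ) → Σ[ xs ] f ≡ 0ℚ
  Σ-zero []       f f≡0 = refl
  Σ-zero (x ∷ xs) f f≡0 = begin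
    f x + Σ[ xs ] f ≡⟨ cong₂ _+_ (f≡0 x (here refl)) (Σ-zero xs f (λ y y∈ → f≡0 y (there y∈))) ⟩
    0ℚ + 0ℚ         ≡⟨ +-identityˡ 0ℚ ⟩
    0ℚ              ∎
    where open ≡-Reasoning

  Σ-+ : (xs : List A) (f g : A → ℚ) → Σ[ xs ] (λ x → f x + g x) ≡ Σ[ xs ] f + Σ[ xs ] g
  Σ-+ []       f g = sym (+-identityˡ 0ℚ)
  Σ-+ (x ∷ xs) f g = trans (cong ((f x + g x) +_) (Σ-+ xs f g))
    (+-interchange (f x) (g x) (Σ[ xs ] f) (Σ[ xs ] g))
    where
    +-interchange : ∀ a b c d → (a + b) + (c + d) ≡ (a + c) + (b + d)
    +-interchange = solve-∀ ℚ-ring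

  Σ-- : (xs : List A) (f g : A → ℚ) → Σ[ xs ] (λ x → f x - g x) ≡ Σ[ xs ] f - Σ[ xs ] g
  Σ-- []       f g = refl
  Σ-- (x ∷ xs) f g = trans (cong ((f x - g x) +_) (Σ-- xs f g))
    (−-interchange (f x) (g x) (Σ[ xs ] f) (Σ[ xs ] g))
    where
    −-interchange : ∀ a b c d → (a - b) + (c - d) ≡ (a + c) - (b + d)
    −-interchange = solve-∀ ℚ-ring

  Σ-*ˡ : (xs : List A) (c : ℚ) (f : A → ℚ) → c * Σ[ xs ] f ≡ Σ[ xs ] (λ x → c * f x)
  Σ-*ˡ []       c f = *-zeroʳ c
  Σ-*ˡ (x ∷ xs) c f =
    trans (*-distribˡ-+ c (f x) (Σ[ xs ] f)) (cong (c * f x +_) (Σ-*ˡ xs c f))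

  Σ-*ʳ : (xs : List A) (c : ℚ) (f : A → ℚ) → Σ[ xs ] f * c ≡ Σ[ xs ] (λ x → f x * c)
  Σ-*ʳ xs c f = trans (*-comm (Σ[ xs ] f) c)
    (trans (Σ-*ˡ xs c f) (Σ-cong xs (λ x → *-comm c (f x))))

  Σ-filter : {P : A → Set} (P? : Decidable P) (xs : List A) (f : A → ℚ) →
    (∀ x → ¬ P x → f x ≡ 0ℚ) → Σ[ filter P? xs ] f ≡ Σ[ xs ] f
  Σ-filter P? []       f f≡0 = refl
  Σ-filter P? (x ∷ xs) f f≡0 with P? x
  ... | yes _  = cong (f x +_) (Σ-filter P? xs f f≡0)
  ... | no ¬Px = begin
    Σ[ filter P? xs ] f ≡⟨ Σ-filter P? xs f f≡0 ⟩
    Σ[ xs ] f           ≡⟨ sym (+-identityˡ _) ⟩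
    0ℚ + Σ[ xs ] f      ≡⟨ cong (_+ Σ[ xs ] f) (sym (f≡0 x ¬Px)) ⟩
    f x + Σ[ xs ] f     ∎
    where open ≡-Reasoning

Σ-swap : {A B : Set} (xs : List A) (ys : List B) (f : A → B → ℚ) →
  Σ[ xs ] (λ x → Σ[ ys ] (f x)) ≡ Σ[ ys ] (λ y → Σ[ xs ] (λ x → f x y))
Σ-swap []       ys f = sym (Σ-zero ys _ (λ _ _ → refl))
Σ-swap (x ∷ xs) ys f = trans (cong (Σ[ ys ] (f x) +_) (Σ-swap xs ys f))
  (sym (Σ-+ ys (f x) (λ y → Σ[ xs ] (λ x′ → f x′ y))))

Σ-Σ-*-assoc : {A B : Set} (xs : List A) (ys : List B) (a : A → ℚ) (b : A → B → ℚ) (c : B → ℚ) →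
  Σ[ xs ] (λ x → a x * Σ[ ys ] (λ y → b x y * c y)) ≡ Σ[ ys ] (λ y → Σ[ xs ] (λ x → a x * b x y) * c y)
Σ-Σ-*-assoc xs ys a b c = begin
  Σ[ xs ] (λ x → a x * Σ[ ys ] (λ y → b x y * c y))   ≡⟨ Σ-cong xs (λ x → Σ-*ˡ ys (a x) (λ y → b x y * c y)) ⟩
  Σ[ xs ] (λ x → Σ[ ys ] (λ y → a x * (b x y * c y))) ≡⟨ Σ-swap xs ys (λ x y → a x * (b x y * c y)) ⟩
  Σ[ ys ] (λ y → Σ[ xs ] (λ x → a x * (b x y * c y))) ≡⟨ Σ-cong ys (λ y → Σ-cong xs (λ x → sym (*-assoc (a x) (b x y) (c y)))) ⟩
  Σ[ ys ] (λ y → Σ[ xs ] (λ x → a x * b x y * c y))   ≡⟨ Σ-cong ys (λ y → sym (Σ-*ʳ xs (c y) (λ x → a x * b x y))) ⟩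
  Σ[ ys ] (λ y → Σ[ xs ] (λ x → a x * b x y) * c y)   ∎
  where open ≡-Reasoning

square-nonNeg : ∀ x → 0ℚ ≤ x * x
square-nonNeg x with ≤-total 0ℚ x
... | inj₁ 0≤x = nonNegative⁻¹ (x * x)
  {{nonNeg*nonNeg⇒nonNeg x {{nonNegative 0≤x}} x {{nonNegative 0≤x}}}}
... | inj₂ x≤0 = nonNegative⁻¹ (x * x)
  {{nonPos*nonPos⇒nonPos x {{nonPositive x≤0}} x {{nonPositive x≤0}}}}

square≡0⇒≡0 : ∀ x → x * x ≡ 0ℚ → x ≡ 0ℚ
square≡0⇒≡0 x x²≡0 with x ≟ 0ℚ
... | yes x≡0 = x≡0
... | no  x≢0 = begin
    x                ≡⟨ sym (*-identityˡ x) ⟩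
    1ℚ * x           ≡⟨ cong (_* x) (sym (*-inverseˡ x)) ⟩
    (1/ x) * x * x   ≡⟨ *-assoc (1/ x) x x ⟩
    (1/ x) * (x * x) ≡⟨ cong ((1/ x) *_) x²≡0 ⟩
    (1/ x) * 0ℚ      ≡⟨ *-zeroʳ (1/ x) ⟩
    0ℚ               ∎
  where
  open ≡-Reasoning
  instance _ = ≢-nonZero x≢0

nonNeg+nonNeg≡0⇒≡0 : ∀ {a b} → 0ℚ ≤ a → 0ℚ ≤ b → a + b ≡ 0ℚ → a ≡ 0ℚ
nonNeg+nonNeg≡0⇒≡0 {a} {b} 0≤a 0≤b a+b≡0 = ≤-antisym a≤0 0≤a
  where
  open ≤-Reasoning
  a≤0 : a ≤ 0ℚ
  a≤0 = begin
    a      ≡⟨ sym (+-identityʳ a) ⟩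
    a + 0ℚ ≤⟨ +-monoʳ-≤ a 0≤b ⟩
    a + b  ≡⟨ a+b≡0 ⟩
    0ℚ     ∎

Σ-nonNeg : {A : Set} (xs : List A) (f : A → ℚ) → (∀ x → 0ℚ ≤ f x) → 0ℚ ≤ Σ[ xs ] f
Σ-nonNeg []       f 0≤f = ≤-refl
Σ-nonNeg (x ∷ xs) f 0≤f =
  ≤-trans (≤-reflexive (sym (+-identityˡ 0ℚ))) (+-mono-≤ (0≤f x) (Σ-nonNeg xs f 0≤f))

Σ-squares≡0⇒≡0 : {A : Set} (xs : List A) (f : A → ℚ) →
  Σ[ xs ] (λ x → f x * f x) ≡ 0ℚ → ∀ x → x ∈ xs → f x ≡ 0ℚ
Σ-squares≡0⇒≡0 (y ∷ xs) f Σ≡0 x (here refl) = square≡0⇒≡0 (f y)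
  (nonNeg+nonNeg≡0⇒≡0 (square-nonNeg (f y)) (Σ-nonNeg xs _ (λ z → square-nonNeg (f z))) Σ≡0)
Σ-squares≡0⇒≡0 (y ∷ xs) f Σ≡0 x (there x∈xs) = Σ-squares≡0⇒≡0 xs f
  (nonNeg+nonNeg≡0⇒≡0 (Σ-nonNeg xs _ (λ z → square-nonNeg (f z))) (square-nonNeg (f y))
    (trans (+-comm _ (f y * f y)) Σ≡0))
  x x∈xs

module Gram {A B : Set} (rows : List A) (cols : List B) (W : A → B → ℚ) where

  gram : A → A → ℚ
  gram e f = Σ[ cols ] (λ t → W e t * W f t)

  gram· : (A → ℚ) → A → ℚ
  gram· y e = Σ[ rows ] (λ f → gram e f * y f)

  transpose· : (A → ℚ) → B → ℚ
  transpose· y t = Σ[ rows ] (λ e → W e t * y e)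

  quadraticForm≡Σ-squares : (y : A → ℚ) →
    Σ[ rows ] (λ e → y e * gram· y e) ≡ Σ[ cols ] (λ t → transpose· y t * transpose· y t)
  quadraticForm≡Σ-squares y = begin
    Σ[ E ] (λ e → y e * Σ[ E ] (λ f → gram e f * y f))
      ≡⟨ Σ-cong E (λ e → trans (Σ-*ˡ E (y e) _) (Σ-cong E (λ f → expand e f))) ⟩
    Σ[ E ] (λ e → Σ[ E ] (λ f → Σ[ T ] (λ t → term e f t)))
      ≡⟨ Σ-cong E (λ e → Σ-swap E T (term e)) ⟩
    Σ[ E ] (λ e → Σ[ T ] (λ t → Σ[ E ] (λ f → term e f t)))
      ≡⟨ Σ-swap E T (λ e t → Σ[ E ] (λ f → term e f t)) ⟩
    Σ[ T ] (λ t → Σ[ E ] (λ e → Σ[ E ] (λ f → term e f t)))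
      ≡⟨ Σ-cong T (λ t → Σ-cong E (λ e → sym (Σ-*ˡ E (W e t * y e) _))) ⟩
    Σ[ T ] (λ t → Σ[ E ] (λ e → (W e t * y e) * transpose· y t))
      ≡⟨ Σ-cong T (λ t → sym (Σ-*ʳ E (transpose· y t) (λ e → W e t * y e))) ⟩
    Σ[ T ] (λ t → transpose· y t * transpose· y t) ∎
    where
    open ≡-Reasoning
    E = rows
    T = cols
    term : A → A → B → ℚ
    term e f t = (W e t * y e) * (W f t * y f)
    regroup : ∀ a b c d → a * (b * c * d) ≡ (b * a) * (c * d)
    regroup = solve-∀ ℚ-ring
    expand : ∀ e f → y e * (gram e f * y f) ≡ Σ[ T ] (term e f)
    expand e f = begin
      y e * (gram e f * y f)                      ≡⟨ cong (y e *_) (Σ-*ʳ T (y f) (λ t → W e t * W f t)) ⟩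
      y e * Σ[ T ] (λ t → W e t * W f t * y f)    ≡⟨ Σ-*ˡ T (y e) _ ⟩
      Σ[ T ] (λ t → y e * (W e t * W f t * y f))  ≡⟨ Σ-cong T (λ t → regroup (y e) (W e t) (W f t) (y f)) ⟩
      Σ[ T ] (term e f)                           ∎

  gram-kernel⇒transpose-kernel : (y : A → ℚ) → (∀ e → gram· y e ≡ 0ℚ) →
    ∀ t → t ∈ cols → transpose· y t ≡ 0ℚ
  gram-kernel⇒transpose-kernel y gy≡0 = Σ-squares≡0⇒≡0 cols (transpose· y) (begin
    Σ[ cols ] (λ t → transpose· y t * transpose· y t) ≡⟨ sym (quadraticForm≡Σ-squares y) ⟩
    Σ[ rows ] (λ e → y e * gram· y e)                 ≡⟨ Σ-zero rows _ (λ e _ → yGy≡0 e) ⟩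
    0ℚ                                                ∎)
    where
    open ≡-Reasoning
    yGy≡0 : ∀ e → y e * gram· y e ≡ 0ℚ
    yGy≡0 e = trans (cong (y e *_) (gy≡0 e)) (*-zeroʳ (y e))

∈-allEdges : {n : ℕ} (e : Edge n) → e ∈ allEdges n
∈-allEdges {n} (p , a , b) =
  ∈-concatMap⁺ edgesOfType (lose (∈-allPairs p)
    (∈-concatMap⁺ (edgesAt p) (lose (∈-allFin a) (∈-map⁺ (λ b → p , a , b) (∈-allFin b)))))
  where
  edgesAt : PartPair → Fin n → List (Edge n)
  edgesAt p a = map (λ b → p , a , b) (allFin n)
  edgesOfType : PartPair → List (Edge n)
  edgesOfType p = concatMap (edgesAt p) (allFin n)
  ∈-allPairs : (p : PartPair) → p ∈ allPairs
  ∈-allPairs p01 = here refl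
  ∈-allPairs p02 = there (here refl)
  ∈-allPairs p12 = there (there (here refl))

column : (n : ℕ) → Triangle n → Vect n
column n t e = W n e t

column⊥kerM : (n : ℕ) (t : Triangle n) → t ∈ allTriangles n →
  (y : Vect n) → InKerM n y → inner (column n t) y ≡ 0ℚ
column⊥kerM n t t∈T y y∈ker =
  Gram.gram-kernel⇒transpose-kernel (allEdges n) (allTriangles n) (W n) y y∈ker t t∈T

orthProjKerM-annihilates-⊥ : (n : ℕ) (K : Edge n → Edge n → ℚ) → IsOrthProjKerM n K →
  (w : Vect n) → (∀ y → InKerM n y → inner w y ≡ 0ℚ) → ∀ e → (K ·ᵥ w) e ≡ 0ℚ
orthProjKerM-annihilates-⊥ n K K-proj w w⊥ker e =
  Σ-squares≡0⇒≡0 (allEdges n) z ⟨z,z⟩≡0 e (∈-allEdges e)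
  where
  open ≡-Reasoning
  z : Vect n
  z = K ·ᵥ w
  z∈ker : InKerM n z
  z∈ker = proj₁ (K-proj w)
  split : ∀ a b → (a - b) * b ≡ a * b - b * b
  split = solve-∀ ℚ-ring
  cancel : ∀ a b → a - (a - b) ≡ b
  cancel = solve-∀ ℚ-ring
  ⟨z,z⟩≡0 : inner z z ≡ 0ℚ
  ⟨z,z⟩≡0 = begin
    inner z z
      ≡⟨ sym (cancel (inner w z) (inner z z)) ⟩
    inner w z - (inner w z - inner z z)
      ≡⟨ cong (inner w z -_) (sym (Σ-- (allEdges n) (λ e → w e * z e) (λ e → z e * z e))) ⟩
    inner w z - Σ[ allEdges n ] (λ e → w e * z e - z e * z e)
      ≡⟨ cong (inner w z -_) (Σ-cong (allEdges n) (λ e → sym (split (w e) (z e)))) ⟩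
    inner w z - inner (λ e → w e - z e) z
      ≡⟨ cong₂ _-_ (w⊥ker z z∈ker) (proj₂ (K-proj w) z z∈ker) ⟩
    0ℚ - 0ℚ
      ≡⟨⟩
    0ℚ ∎

side : {n : ℕ} → PartPair → Triangle n → Edge n
side p01 (a , b , c) = p01 , a , b
side p02 (a , b , c) = p02 , a , c
side p12 (a , b , c) = p12 , b , c

∧≡true⇒ : ∀ {a b} → a ∧ b ≡ true → a ≡ true × b ≡ true
∧≡true⇒ {true} b≡true = refl , b≡true

≟ᶠ-true⇒≡ : {n : ℕ} {x a : Fin n} → ⌊ x ≟ᶠ a ⌋ ≡ true → x ≡ a
≟ᶠ-true⇒≡ x≟a = toWitness (Equivalence.from T-≡ x≟a)

edge-≟ᶠ-true⇒≡ : {n : ℕ} {p : PartPair} {x y a b : Fin n} →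
  ⌊ x ≟ᶠ a ⌋ ∧ ⌊ y ≟ᶠ b ⌋ ≡ true → (p , x , y) ≡ (p , a , b)
edge-≟ᶠ-true⇒≡ {p = p} eq with ∧≡true⇒ eq
... | x≟a , y≟b = cong₂ (λ u v → p , u , v) (≟ᶠ-true⇒≡ x≟a) (≟ᶠ-true⇒≡ y≟b)

⊆ᵗ⇒≡side : {n : ℕ} (p : PartPair) (x y : Fin n) (t : Triangle n) →
  (p , x , y) ⊆ᵗ t ≡ true → (p , x , y) ≡ side p t
⊆ᵗ⇒≡side p01 x y (a , b , c) = edge-≟ᶠ-true⇒≡
⊆ᵗ⇒≡side p02 x y (a , b , c) = edge-≟ᶠ-true⇒≡
⊆ᵗ⇒≡side p12 x y (a , b , c) = edge-≟ᶠ-true⇒≡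

triangleIn⇒side∈ : {n : ℕ} (G : Subgraph n) (t : Triangle n) →
  triangleIn G t ≡ true → ∀ p → G (side p t) ≡ true
triangleIn⇒side∈ G (a , b , c) t∈G p
  with ∧≡true⇒ {G (p01 , a , b)} t∈G
... | in01 , in02∧in12 with ∧≡true⇒ {G (p02 , a , c)} in02∧in12
...   | in02 , in12 = sides p
  where
  sides : ∀ p → G (side p (a , b , c)) ≡ true
  sides p01 = in01
  sides p02 = in02
  sides p12 = in12

triangleIn⇒edges∈ : {n : ℕ} (G : Subgraph n) (t : Triangle n) (g : Edge n) →
  triangleIn G t ≡ true → g ⊆ᵗ t ≡ true → G g ≡ true
triangleIn⇒edges∈ G t (p , x , y) t∈G g⊆t =
  subst (λ g → G g ≡ true) (sym (⊆ᵗ⇒≡side p x y t g⊆t)) (triangleIn⇒side∈ G t t∈G p)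

column-outside≡0 : {n : ℕ} (G : Subgraph n) (t : Triangle n) (g : Edge n) →
  triangleIn G t ≡ true → ¬ G g ≡ true → column n t g ≡ 0ℚ
column-outside≡0 G t g t∈G g∉G with g ⊆ᵗ t in g⊆t
... | true  = ⊥-elim (g∉G (triangleIn⇒edges∈ G t g t∈G g⊆t))
... | false = refl

Σ-edgesOf-column : {n : ℕ} (G : Subgraph n) (t : Triangle n) (x : Vect n) →
  triangleIn G t ≡ true → Σ[ edgesOf G ] (λ g → x g * column n t g) ≡ inner x (column n t)
Σ-edgesOf-column {n} G t x t∈G =
  Σ-filter (λ g → G g ≟ᵇ true) (allEdges n) (λ g → x g * column n t g) outside≡0
  where
  outside≡0 : ∀ g → ¬ G g ≡ true → x g * column n t g ≡ 0ℚ
  outside≡0 g g∉G = trans (cong (x g *_) (column-outside≡0 G t g t∈G g∉G)) (*-zeroʳ (x g))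

proposition2p5 : (n : ℕ) (G : Subgraph n) (K : Edge n → Edge n → ℚ) →
    IsOrthProjKerM n K → (e f : Edge n) → G e ≡ true → G f ≡ true →
    KG-MG K G e f ≡ 0ℚ
proposition2p5 n G K K-proj e f _ _ = begin
  KG-MG K G e f
    ≡⟨ Σ-Σ-*-assoc (edgesOf G) (trianglesOf G) (K e) (λ g t → column n t g) (λ t → column n t f) ⟩
  Σ[ trianglesOf G ] (λ t → Σ[ edgesOf G ] (λ g → K e g * column n t g) * column n t f)
    ≡⟨ Σ-zero (trianglesOf G) _ (λ t t∈TG → trans (cong (_* column n t f) (Kw≡0 t t∈TG)) (*-zeroˡ (column n t f))) ⟩
  0ℚ ∎
  where
  open ≡-Reasoning
  Kw≡0 : ∀ t → t ∈ trianglesOf G → Σ[ edgesOf G ] (λ g → K e g * column n t g) ≡ 0ℚ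
  Kw≡0 t t∈TG with ∈-filter⁻ (λ t → triangleIn G t ≟ᵇ true) {xs = allTriangles n} t∈TG
  ... | t∈T , t∈G = trans (Σ-edgesOf-column G t (K e) t∈G)
    (orthProjKerM-annihilates-⊥ n K K-proj (column n t) (column⊥kerM n t t∈T) e)
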